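{- For every hypergraph $H$, $\chi_{min}\le\chi_{cf}(H)$.
   Context: A hypergraph $H=(\mathcal{V},\mathcal{E})$ has finite vertex set $\mathcal{V}$ and a set $\mathcal{E}$ of non-empty subsets of $\mathcal{V}$. A conflict-free colouring of $H$ is a function $C:\mathcal{V}\to\{0,1,2,\dots\}$ such that for every $E\in\mathcal{E}$ there is $j\ge1$ with $|E\cap C^{ -1}(j)|=1$; $\chi_{cf}(H)$ is the minimum number of non-zero colours used by such a colouring. A representative function is a map $t:\mathcal{E}\to\mathcal{V}$ with $t(E)\in E$; $R=t(\mathcal{E})$. The co-occurrence graph $G_{R,t}$ has vertex set $R$, with distinct $u,v$ adjacent iff some $E\in\mathcal{E}$ has $u,v\in E$ and $t(E)\in\{u,v\}$. $\chi_{min}=\min_{R,t}\chi(G_{R,t})$ over all representative functions $t$, where $\chi$ denotes chromatic number. -}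

module Defs where

open import Data.Nat using (ℕ; zero; suc; _≥_; _≟_)
open import Data.Fin using (Fin)
open import Data.Fin.Subset using (Subset; _∈_; Nonempty)
open import Data.List using (List; length; map; filter; deduplicate)
open import Data.List.Base using (allFin)
open import Data.Product using (Σ; ∃; _×_; _,_; proj₁)
open import Data.Sum using (_⊎_)
open import Relation.Nullary using (¬_; ¬?)
open import Relation.Binary.PropositionalEquality using (_≡_; _≢_)

-- A hypergraph with vertex set Fin n and edge set {edge i | i : Fin m}.
-- Edges are non-empty and pairwise distinct (so the indexed family is a set).
record Hypergraph : Set where
  field
    n        : ℕ
    m        : ℕ
    edge     : Fin m → Subset n
    nonempty : (i : Fin m) → Nonempty (edge i)
    distinct : (i j : Fin m) → edge i ≡ edge j → i ≡ j

module _ (H : Hypergraph) where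
  open Hypergraph H

  Colouring : Set
  Colouring = Fin n → ℕ

  -- |E ∩ C⁻¹(j)| = 1, written out as unique existence
  UniqueColourIn : Colouring → Subset n → ℕ → Set
  UniqueColourIn C E j =
    Σ (Fin n) λ v → (v ∈ E) × (C v ≡ j) ×
      ((w : Fin n) → w ∈ E → C w ≡ j → w ≡ v)

  IsConflictFree : Colouring → Set
  IsConflictFree C = (i : Fin m) → Σ ℕ λ j → (j ≥ 1) × UniqueColourIn C (edge i) j

  nonzeroColoursUsed : Colouring → ℕ
  nonzeroColoursUsed C =
    length (deduplicate _≟_ (filter (λ x → ¬? (x ≟ 0)) (map C (allFin n))))

  record Representative : Set where
    field
      t   : Fin m → Fin n
      t∈  : (i : Fin m) → t i ∈ edge i

  module _ (T : Representative) where
    open Representative T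

    InR : Fin n → Set
    InR u = Σ (Fin m) λ i → t i ≡ u

    R : Set
    R = Σ (Fin n) InR

    Adjacent : R → R → Set
    Adjacent (u , _) (v , _) =
      (u ≢ v) × Σ (Fin m) λ i → (u ∈ edge i) × (v ∈ edge i) × ((t i ≡ u) ⊎ (t i ≡ v))

    ProperColouring : ℕ → Set
    ProperColouring k =
      Σ (R → Fin k) λ c → (x y : R) → Adjacent x y → c x ≢ c y

module Submission where

-- Let C be a conflict-free colouring of H.  For every edge E
-- choose as representative t(E) the vertex of E whose (non-zero) colour
-- occurs exactly once in E.  If u, v are adjacent in G_{R,t}, witnessed by
-- an edge E with t(E) = u (say) and v ∈ E, v ≠ u, then C v ≠ C u, since u is
-- the only vertex of E of colour C u.  So C restricted to R is a proper
-- colouring of G_{R,t}, and all its values are non-zero colours used by C.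
-- Renumbering each colour by its position in the list of distinct non-zero
-- colours used gives a proper colouring with nonzeroColoursUsed H C colours.

open import Defs
open import Data.Product using (Σ; _,_; proj₁; proj₂)
open import Data.Nat using (ℕ; _≟_)
open import Data.Nat.Properties using (m<n⇒n≢0)
open import Data.Fin using (Fin)
open import Data.Fin.Subset using () renaming (_∈_ to _∈ₛ_)
open import Data.Sum using (inj₁; inj₂)
open import Data.List using (List; length; lookup; map; filter; deduplicate)
open import Data.List.Base using (allFin)
open import Data.List.Membership.Propositional using (_∈_)
open import Data.List.Membership.Propositional.Properties
  using (∈-map⁺; ∈-filter⁺; ∈-deduplicate⁺; ∈-allFin)
open import Data.List.Relation.Unary.Any using (index)
open import Data.List.Relation.Unary.Any.Properties using (lookup-index)
open import Relation.Nullary using (¬?)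
open import Relation.Binary.PropositionalEquality using (_≡_; _≢_; refl; sym; trans; cong)

module Renumbering {A B : Set} {f : A → B} {L : List B} (f∈L : (x : A) → f x ∈ L) where

  position : A → Fin (length L)
  position x = index (f∈L x)

  position-reflects : (x y : A) → position x ≡ position y → f x ≡ f y
  position-reflects x y eq =
    trans (lookup-index (f∈L x)) (trans (cong (lookup L) eq) (sym (lookup-index (f∈L y))))

  position-separates : (x y : A) → f x ≢ f y → position x ≢ position y
  position-separates x y fx≢fy eq = fx≢fy (position-reflects x y eq)

module _ (H : Hypergraph) (C : Colouring H) (cf : IsConflictFree H C) where
  open Hypergraph H

  uniqueColour : Fin m → ℕ
  uniqueColour i = proj₁ (cf i)

  uniqueVertex : Fin m → Fin n
  uniqueVertex i = proj₁ (proj₂ (proj₂ (cf i)))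

  uniqueRepresentative : Representative H
  uniqueRepresentative = record
    { t  = uniqueVertex
    ; t∈ = λ i → proj₁ (proj₂ (proj₂ (proj₂ (cf i)))) }

  uniqueVertex-colour : (i : Fin m) → C (uniqueVertex i) ≡ uniqueColour i
  uniqueVertex-colour i = proj₁ (proj₂ (proj₂ (proj₂ (proj₂ (cf i)))))

  uniqueVertex-alone : (i : Fin m) (w : Fin n) → w ∈ₛ edge i →
                       C w ≡ C (uniqueVertex i) → w ≡ uniqueVertex i
  uniqueVertex-alone i w w∈ eq =
    proj₂ (proj₂ (proj₂ (proj₂ (proj₂ (cf i))))) w w∈ (trans eq (uniqueVertex-colour i))

  uniqueVertex-nonzero : (i : Fin m) → C (uniqueVertex i) ≢ 0
  uniqueVertex-nonzero i eq =
    m<n⇒n≢0 (proj₁ (proj₂ (cf i))) (trans (sym (uniqueVertex-colour i)) eq)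

  -- Adjacent vertices of the co-occurrence graph receive different colours:
  -- the witnessing edge has one of them as its uniquely coloured vertex.
  adjacent⇒colours-differ : (x y : R H uniqueRepresentative) →
                            Adjacent H uniqueRepresentative x y → C (proj₁ x) ≢ C (proj₁ y)
  adjacent⇒colours-differ (u , _) (v , _) (u≢v , i , u∈ , v∈ , inj₁ refl) eq =
    u≢v (sym (uniqueVertex-alone i v v∈ (sym eq)))
  adjacent⇒colours-differ (u , _) (v , _) (u≢v , i , u∈ , v∈ , inj₂ refl) eq =
    u≢v (uniqueVertex-alone i u u∈ eq)

  representative-colour-used : (x : R H uniqueRepresentative) →
    C (proj₁ x) ∈ deduplicate _≟_ (filter (λ c → ¬? (c ≟ 0)) (map C (allFin n)))
  representative-colour-used (u , i , refl) =
    ∈-deduplicate⁺ _≟_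
      (∈-filter⁺ (λ c → ¬? (c ≟ 0)) (∈-map⁺ C (∈-allFin u)) (uniqueVertex-nonzero i))

lemma2 : (H : Hypergraph) (C : Colouring H) → IsConflictFree H C →
         Σ (Representative H) λ T → ProperColouring H T (nonzeroColoursUsed H C)
lemma2 H C cf =
  uniqueRepresentative H C cf , position , λ x y adj →
    position-separates x y (adjacent⇒colours-differ H C cf x y adj)
  where open Renumbering (representative-colour-used H C cf)
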